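{- Let $n\geq 3$ be an integer, let $(x_1,\ldots,x_n)$ be positive integers with $x_1\leq\cdots\leq x_n$, and let $m$ be an integer with $$m=\sigma_2(x_1,\ldots,x_n)=\sigma_n(x_1,\ldots,x_n).$$ Then $m\leq n^2(3n-5)$ and $x_n\leq\frac{1}{2}n(3n-5)$.
   Context: $\sigma_k$ denotes the $k$-th elementary symmetric polynomial in $n$ variables. -}

module Defs where

open import Data.Nat using (ℕ; zero; suc; _+_; _*_)
open import Data.Vec using (Vec; []; _∷_)

σ : ℕ → {n : ℕ} → Vec ℕ n → ℕ
σ zero    _        = 1
σ (suc k) []       = 0
σ (suc k) (x ∷ xs) = x * σ k xs + σ (suc k) xs

{-# OPTIONS --safe #-}
-- Write x = (1 + h₁, …, 1 + h_N, y) with N = n − 1, P = ∏ (1 + hᵢ) and H = Σ hᵢ.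
-- Then σₙ(x) = y P and σ₂(x) = σ₂(1 + h) + y (N + H), so the hypothesis says
-- y g = σ₂(1 + h), where g = P − N − H ≥ 1 is the excess of the product over the sum.
-- Expanding σ₂(1 + h) through H and σ₂(h), and using σ₂(h) ≤ P − 1 − H and 2H ≤ P
-- (valid once two hᵢ are positive), gives 2yg ≤ C + 2Ng with C = (N − 1)(3N + 2);
-- as g ≥ 1 this is 2y ≤ C + 2N = n(3n − 5). Bounding H by N(y − 1) instead, since
-- every entry is at most y, gives 2g ≤ C; then m = yP ≤ 2y(N + g) and the first
-- estimate yield m g ≤ (C + 2Ng)(N + g) ≤ n (C + 2N) g, i.e. m ≤ n²(3n − 5).
module Submission where

open import Defs
open import Data.Nat using (ℕ; zero; suc; _+_; _*_; _∸_; _≤_; _<_; s≤s; z≤n; NonZero; >-nonZero)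
open import Data.Nat.Properties
open import Data.Nat.Tactic.RingSolver using (solve-∀)
open import Data.Fin using (Fin; fromℕ; cast; inject₁)
import Data.Fin as Fin
open import Data.Fin.Properties using (cast-is-id; ≤fromℕ)
open import Data.Vec using (Vec; []; _∷_; lookup; map; _∷ʳ_; initLast)
open import Data.Vec.Properties using (lookup-map)
open import Data.Product using (_×_; _,_; ∃-syntax; proj₁; proj₂)
open import Data.Sum using (_⊎_; inj₁; inj₂; [_,_]′)
open import Data.Empty using (⊥-elim)
open import Function using (_∘_; id)
open import Relation.Binary.PropositionalEquality

σ-vanishes : ∀ {N} (w : Vec ℕ N) k → N < k → σ k w ≡ 0
σ-vanishes []      (suc k) _        = refl
σ-vanishes (b ∷ w) (suc k) (s≤s N<k)
  rewrite σ-vanishes w k N<k | σ-vanishes w (suc k) (m<n⇒m<1+n N<k) | *-zeroʳ b = refl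

σ₁-∷ : ∀ {N} b (w : Vec ℕ N) → σ 1 (b ∷ w) ≡ b + σ 1 w
σ₁-∷ b w = cong (_+ σ 1 w) (*-identityʳ b)

σ-top-∷ : ∀ {N} b (w : Vec ℕ N) → σ (suc N) (b ∷ w) ≡ b * σ N w
σ-top-∷ {N} b w = trans (cong (b * σ N w +_) (σ-vanishes w (suc N) ≤-refl)) (+-identityʳ _)

σ-∷ʳ : ∀ {N} (w : Vec ℕ N) y k → σ (suc k) (w ∷ʳ y) ≡ σ (suc k) w + y * σ k w
σ-∷ʳ []      y zero    = +-identityʳ (y * 1)
σ-∷ʳ []      y (suc k) = +-identityʳ (y * 0)
σ-∷ʳ (b ∷ w) y zero    = trans (cong (b * 1 +_) (σ-∷ʳ w y zero)) (sym (+-assoc (b * 1) (σ 1 w) (y * 1)))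
σ-∷ʳ (b ∷ w) y (suc k)
  rewrite σ-∷ʳ w y k | σ-∷ʳ w y (suc k) = expand b (σ (suc k) w) (σ k w) (σ (suc (suc k)) w) y
  where
  expand : ∀ b p q r y → b * (p + y * q) + (r + y * p) ≡ b * p + r + y * (b * q + p)
  expand = solve-∀

σ-top-∷ʳ : ∀ {N} (w : Vec ℕ N) y → σ (suc N) (w ∷ʳ y) ≡ y * σ N w
σ-top-∷ʳ {N} w y = trans (σ-∷ʳ w y N) (cong (_+ y * σ N w) (σ-vanishes w (suc N) ≤-refl))

σ-positive : ∀ {N} (h : Vec ℕ N) k → k ≤ N → 1 ≤ σ k (map suc h)
σ-positive h       zero    _         = ≤-refl
σ-positive (b ∷ h) (suc k) (s≤s k≤N) =
  ≤-trans (*-mono-≤ (s≤s (z≤n {b})) (σ-positive h k k≤N)) (m≤m+n _ _)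

σ₁≤N*y : ∀ {N} (w : Vec ℕ N) y → (∀ i → lookup w i ≤ y) → σ 1 w ≤ N * y
σ₁≤N*y []      y _  = z≤n
σ₁≤N*y {suc N} (b ∷ w) y w≤y =
  subst (_≤ suc N * y) (sym (σ₁-∷ b w)) (+-mono-≤ (w≤y Fin.zero) (σ₁≤N*y w y (w≤y ∘ Fin.suc)))

σ₁-map-suc : ∀ {N} (h : Vec ℕ N) → σ 1 (map suc h) ≡ N + σ 1 h
σ₁-map-suc []      = refl
σ₁-map-suc {suc N} (b ∷ h) = begin
  σ 1 (suc b ∷ map suc h)  ≡⟨ σ₁-∷ (suc b) (map suc h) ⟩
  suc b + σ 1 (map suc h)  ≡⟨ cong (suc b +_) (σ₁-map-suc h) ⟩
  suc (b + (N + σ 1 h))    ≡⟨ cong suc (+-comm-left b N (σ 1 h)) ⟩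
  suc (N + (b + σ 1 h))    ≡⟨ cong (suc N +_) (sym (σ₁-∷ b h)) ⟩
  suc N + σ 1 (b ∷ h)      ∎
  where
  open ≡-Reasoning
  +-comm-left : ∀ a b c → a + (b + c) ≡ b + (a + c)
  +-comm-left = solve-∀

σ₂-map-suc : ∀ {N} (h : Vec ℕ N) →
  2 * σ 2 (map suc h) + 2 * σ 1 h + N ≡ N * N + 2 * N * σ 1 h + 2 * σ 2 h
σ₂-map-suc []      = refl
σ₂-map-suc (b ∷ h)
  rewrite σ₁-map-suc h | σ₁-∷ b h = step b _ (σ 1 h) (σ 2 h) (σ 2 (map suc h)) (σ₂-map-suc h)
  where
  isolate : ∀ b N H T → 2 * (suc b * (N + H) + T) + 2 * (b + H) + suc N ≡ (2 * T + 2 * H + N) + (2 * suc b * (N + H) + 2 * b + 1)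
  isolate = solve-∀
  recombine : ∀ b N H S → (N * N + 2 * N * H + 2 * S) + (2 * suc b * (N + H) + 2 * b + 1) ≡ suc N * suc N + 2 * suc N * (b + H) + 2 * (b * H + S)
  recombine = solve-∀
  step : ∀ b N H S T → 2 * T + 2 * H + N ≡ N * N + 2 * N * H + 2 * S →
    2 * (suc b * (N + H) + T) + 2 * (b + H) + suc N ≡ suc N * suc N + 2 * suc N * (b + H) + 2 * (b * H + S)
  step b N H S T ih = begin
    2 * (suc b * (N + H) + T) + 2 * (b + H) + suc N
      ≡⟨ isolate b N H T ⟩
    (2 * T + 2 * H + N) + (2 * suc b * (N + H) + 2 * b + 1)
      ≡⟨ cong (_+ (2 * suc b * (N + H) + 2 * b + 1)) ih ⟩
    (N * N + 2 * N * H + 2 * S) + (2 * suc b * (N + H) + 2 * b + 1)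
      ≡⟨ recombine b N H S ⟩
    suc N * suc N + 2 * suc N * (b + H) + 2 * (b * H + S) ∎
    where open ≡-Reasoning

σ₂-∷ʳ-map-suc : ∀ {N} (h : Vec ℕ N) y → σ 2 (map suc h ∷ʳ y) ≡ σ 2 (map suc h) + y * (N + σ 1 h)
σ₂-∷ʳ-map-suc h y = trans (σ-∷ʳ (map suc h) y 1) (cong (λ s → σ 2 (map suc h) + y * s) (σ₁-map-suc h))

σ-top-map-suc-≥ : ∀ {N} (h : Vec ℕ N) → 1 + σ 1 h + σ 2 h ≤ σ N (map suc h)
σ-top-map-suc-≥ []      = ≤-refl
σ-top-map-suc-≥ (b ∷ h)
  rewrite σ-top-∷ (suc b) (map suc h) | σ₁-∷ b h = step b (σ-top-map-suc-≥ h)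
  where
  expand : ∀ b H S → 1 + (b + H) + (b * H + S) + b * S ≡ suc b * (1 + H + S)
  expand = solve-∀
  step : ∀ b {H S P} → 1 + H + S ≤ P → 1 + (b + H) + (b * H + S) ≤ suc b * P
  step b {H} {S} {P} ih = begin
    1 + (b + H) + (b * H + S)            ≤⟨ m≤m+n _ (b * S) ⟩
    1 + (b + H) + (b * H + S) + b * S    ≡⟨ expand b H S ⟩
    suc b * (1 + H + S)                  ≤⟨ *-monoʳ-≤ (suc b) ih ⟩
    suc b * P                            ∎
    where open ≤-Reasoning

σ-top-map-suc-dichotomy : ∀ {N} (h : Vec ℕ N) →
  σ N (map suc h) ≡ suc (σ 1 h) ⊎ (1 ≤ σ 1 h × 2 * σ 1 h ≤ σ N (map suc h))
σ-top-map-suc-dichotomy []      = inj₁ refl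
σ-top-map-suc-dichotomy (b ∷ h)
  rewrite σ-top-∷ (suc b) (map suc h) | σ₁-∷ b h = step b (σ-top-map-suc-dichotomy h)
  where
  expand : ∀ b H → 2 * (suc b + suc H) + b * H ≡ suc (suc b) * suc (suc H)
  expand = solve-∀
  distrib : ∀ b H → 2 * (b + H) ≡ 2 * H + b * 2
  distrib = solve-∀
  step : ∀ b {H P} → P ≡ suc H ⊎ (1 ≤ H × 2 * H ≤ P) →
    suc b * P ≡ suc (b + H) ⊎ (1 ≤ b + H × 2 * (b + H) ≤ suc b * P)
  step zero    {H}     (inj₁ refl) = inj₁ (+-identityʳ (suc H))
  step (suc b) {zero}  (inj₁ refl) = inj₁ (trans (*-identityʳ (2 + b)) (cong (2 +_) (sym (+-identityʳ b))))
  step (suc b) {suc H} (inj₁ refl) = inj₂ (s≤s z≤n , ≤-trans (m≤m+n _ (b * H)) (≤-reflexive (expand b H)))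
  step b {H} {P} (inj₂ (1≤H , 2H≤P)) = inj₂ (≤-trans 1≤H (m≤n+m H b) , (begin
    2 * (b + H)    ≡⟨ distrib b H ⟩
    2 * H + b * 2  ≤⟨ +-mono-≤ 2H≤P (*-monoʳ-≤ b (≤-trans (*-monoʳ-≤ 2 1≤H) 2H≤P)) ⟩
    P + b * P      ∎))
    where open ≤-Reasoning

excess-factor : ∀ y {s p t} → 1 ≤ t → t + y * s ≡ y * p →
  ∃[ g ] (1 ≤ g × p ≡ s + g × t ≡ y * g)
excess-factor y {s} {p} {t} 1≤t eq
  with m≤n⇒∃[o]m+o≡n (*-cancelˡ-< y s p (subst (y * s <_) eq (m<n+m (y * s) 1≤t)))
... | o , refl = suc o , s≤s z≤n , sym (+-suc s o) , +-cancelʳ-≡ (y * s) t (y * suc o) (begin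
  t + y * s              ≡⟨ eq ⟩
  y * (suc s + o)        ≡⟨ cong (y *_) (sym (+-suc s o)) ⟩
  y * (s + suc o)        ≡⟨ *-distribˡ-+ y s (suc o) ⟩
  y * s + y * suc o      ≡⟨ +-comm (y * s) (y * suc o) ⟩
  y * suc o + y * s      ∎)
  where open ≡-Reasoning

m+n≤m*o⇒2≤o : ∀ m {n o} → 1 ≤ n → m + n ≤ m * o → 2 ≤ o
m+n≤m*o⇒2≤o m {n} {zero} 1≤n m+n≤m*0
  with ≤-trans 1≤n (≤-trans (m≤n+m n m) (≤-trans m+n≤m*0 (≤-reflexive (*-zeroʳ m))))
... | ()
m+n≤m*o⇒2≤o m {n} {1} 1≤n m+n≤m*1
  with ≤-trans 1≤n (+-cancelˡ-≤ m n 0 (≤-trans m+n≤m*1 (≤-reflexive (trans (*-identityʳ m) (sym (+-identityʳ m))))))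
... | ()
m+n≤m*o⇒2≤o m {o = suc (suc _)} _ _ = s≤s (s≤s z≤n)

σ₂-shift-bound : ∀ M {T H S G B} → let N = suc M in
  2 * T + 2 * H + N ≡ N * N + 2 * N * H + 2 * S → 1 + S ≤ G → H ≤ B →
  2 * T + (N + 2) ≤ N * N + 2 * M * B + 2 * G
σ₂-shift-bound M {T} {H} {S} {G} {B} eq 1+S≤G H≤B = +-cancelˡ-≤ (2 * H) _ _ (begin
  2 * H + (2 * T + (suc M + 2))                      ≡⟨ rearrange M T H ⟩
  2 * T + 2 * H + suc M + 2                          ≡⟨ cong (_+ 2) eq ⟩
  suc M * suc M + 2 * suc M * H + 2 * S + 2          ≡⟨ split M H S ⟩
  2 * H + (suc M * suc M + 2 * M * H + 2 * (1 + S))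
    ≤⟨ +-monoʳ-≤ (2 * H) (+-mono-≤ (+-monoʳ-≤ (suc M * suc M) (*-monoʳ-≤ (2 * M) H≤B)) (*-monoʳ-≤ 2 1+S≤G)) ⟩
  2 * H + (suc M * suc M + 2 * M * B + 2 * G)        ∎)
  where
  open ≤-Reasoning
  rearrange : ∀ M T H → 2 * H + (2 * T + (suc M + 2)) ≡ 2 * T + 2 * H + suc M + 2
  rearrange = solve-∀
  split : ∀ M H S → suc M * suc M + 2 * suc M * H + 2 * S + 2 ≡ 2 * H + (suc M * suc M + 2 * M * H + 2 * (1 + S))
  split = solve-∀

-- With N = suc M, the constant M * (3 * M + 5) is C = (N − 1)(3N + 2).
yg-bound : ∀ M {y g H S} → let N = suc M in
  2 * (y * g) + 2 * H + N ≡ N * N + 2 * N * H + 2 * S → 1 + S ≤ N + g → H ≤ N + g →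
  2 * (y * g) ≤ M * (3 * M + 5) + 2 * N * g
yg-bound M {y} {g} eq 1+S≤N+g H≤N+g = +-cancelʳ-≤ (suc M + 2) _ _ (begin
  2 * (y * g) + (suc M + 2)                                ≤⟨ σ₂-shift-bound M {T = y * g} eq 1+S≤N+g H≤N+g ⟩
  suc M * suc M + 2 * M * (suc M + g) + 2 * (suc M + g)    ≡⟨ collect M g ⟩
  M * (3 * M + 5) + 2 * suc M * g + (suc M + 2)            ∎)
  where
  open ≤-Reasoning
  collect : ∀ M g → suc M * suc M + 2 * M * (suc M + g) + 2 * (suc M + g) ≡ M * (3 * M + 5) + 2 * suc M * g + (suc M + 2)
  collect = solve-∀

g-bound : ∀ M {y g H S} → let N = suc M in 2 ≤ y →
  2 * (y * g) + 2 * H + N ≡ N * N + 2 * N * H + 2 * S → 1 + S ≤ N + g → N + H ≤ N * y →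
  2 * g ≤ M * (3 * M + 5)
g-bound M {suc y} {g} {H} (s≤s 1≤y) eq 1+S≤N+g N+H≤Ny =
  *-cancelʳ-≤ (2 * g) (M * (3 * M + 5)) y {{>-nonZero 1≤y}} (begin
    2 * g * y                               ≤⟨ +-cancelˡ-≤ (2 * g + (suc M + 2)) _ _ (begin
      2 * g + (suc M + 2) + 2 * g * y                       ≡⟨ unfold M g y ⟩
      2 * (suc y * g) + (suc M + 2)                         ≤⟨ σ₂-shift-bound M {T = suc y * g} eq 1+S≤N+g H≤Ny ⟩
      suc M * suc M + 2 * M * (suc M * y) + 2 * (suc M + g) ≡⟨ collect M g y ⟩
      2 * g + (suc M + 2) + (M * (M + 3) + 2 * M * suc M * y) ∎) ⟩
    M * (M + 3) + 2 * M * suc M * y         ≤⟨ +-monoˡ-≤ _ (m≤m*n (M * (M + 3)) y {{>-nonZero 1≤y}}) ⟩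
    M * (M + 3) * y + 2 * M * suc M * y     ≡⟨ factor M y ⟩
    M * (3 * M + 5) * y                     ∎)
  where
  open ≤-Reasoning
  H≤Ny : H ≤ suc M * y
  H≤Ny = +-cancelˡ-≤ (suc M) _ _ (≤-trans N+H≤Ny (≤-reflexive (*-suc (suc M) y)))
  unfold : ∀ M g y → 2 * g + (suc M + 2) + 2 * g * y ≡ 2 * (suc y * g) + (suc M + 2)
  unfold = solve-∀
  collect : ∀ M g y → suc M * suc M + 2 * M * (suc M * y) + 2 * (suc M + g) ≡ 2 * g + (suc M + 2) + (M * (M + 3) + 2 * M * suc M * y)
  collect = solve-∀
  factor : ∀ M y → M * (M + 3) * y + 2 * M * suc M * y ≡ M * (3 * M + 5) * y
  factor = solve-∀

product-bound : ∀ N {C g} → 1 ≤ g → 2 * g ≤ C →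
  (C + 2 * N * g) * (N + g) ≤ suc N * (C + 2 * N) * g
product-bound N {g = suc g} _ 2g≤C with m≤n⇒∃[o]m+o≡n 2g≤C
... | d , refl = ≤-trans (m≤m+n _ (N * g * d)) (≤-reflexive (expand N g d))
  where
  -- the slack is N (g - 1) (C - 2 g)
  expand : ∀ N g d → (2 * suc g + d + 2 * N * suc g) * (N + suc g) + N * g * d ≡ suc N * (2 * suc g + d + 2 * N) * suc g
  expand = solve-∀

excess-bounds : ∀ M {y g H S P} → let N = suc M ; K = M * (3 * M + 5) + 2 * N in
  1 ≤ g → P ≡ N + H + g →
  2 * (y * g) + 2 * H + N ≡ N * N + 2 * N * H + 2 * S →
  1 + H + S ≤ P → P ≡ suc H ⊎ (1 ≤ H × 2 * H ≤ P) → N + H ≤ N * y →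
  2 * y ≤ K × y * P ≤ suc N * K
excess-bounds M {y} {g} {H} {S} 1≤g refl eq 1+H+S≤P dichotomy N+H≤Ny = 2y≤K , yP≤nK
  where
  open ≤-Reasoning
  instance
    g≢0 : NonZero g
    g≢0 = >-nonZero 1≤g
  C K : ℕ
  C = M * (3 * M + 5)
  K = C + 2 * suc M

  shuffle : suc M + H + g ≡ H + (suc M + g)
  shuffle = +-comm-left (suc M) H g
    where
    +-comm-left : ∀ a b c → a + b + c ≡ b + (a + c)
    +-comm-left = solve-∀

  1≤H×2H≤P : 1 ≤ H × 2 * H ≤ suc M + H + g
  1≤H×2H≤P = [ (λ P≡1+H → ⊥-elim (1+n≰n (subst (2 + H ≤_) P≡1+H 2+H≤P))) , id ]′ dichotomy
    where
    2+H≤P : 2 + H ≤ suc M + H + g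
    2+H≤P = s≤s (≤-trans (m<m+n H 1≤g) (≤-trans (m≤n+m (H + g) M) (≤-reflexive (sym (+-assoc M H g)))))

  1+S≤N+g : 1 + S ≤ suc M + g
  1+S≤N+g = +-cancelˡ-≤ H _ _ (subst₂ _≤_ (sym (+-suc H S)) shuffle 1+H+S≤P)

  H≤N+g : H ≤ suc M + g
  H≤N+g = +-cancelˡ-≤ H _ _ (subst₂ _≤_ (cong (H +_) (+-identityʳ H)) shuffle (proj₂ 1≤H×2H≤P))

  yg≤ : 2 * (y * g) ≤ C + 2 * suc M * g
  yg≤ = yg-bound M {y = y} eq 1+S≤N+g H≤N+g

  2g≤C : 2 * g ≤ C
  2g≤C = g-bound M (m+n≤m*o⇒2≤o (suc M) (proj₁ 1≤H×2H≤P) N+H≤Ny) eq 1+S≤N+g N+H≤Ny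

  2y≤K : 2 * y ≤ K
  2y≤K = *-cancelʳ-≤ (2 * y) K g (begin
    2 * y * g              ≡⟨ *-assoc 2 y g ⟩
    2 * (y * g)            ≤⟨ yg≤ ⟩
    C + 2 * suc M * g      ≤⟨ +-monoˡ-≤ (2 * suc M * g) (m≤m*n C g) ⟩
    C * g + 2 * suc M * g  ≡⟨ sym (*-distribʳ-+ g C (2 * suc M)) ⟩
    K * g                  ∎)

  yP≤nK : y * (suc M + H + g) ≤ suc (suc M) * K
  yP≤nK = *-cancelʳ-≤ (y * (suc M + H + g)) (suc (suc M) * K) g (begin
    y * (suc M + H + g) * g             ≤⟨ *-monoˡ-≤ g (*-monoʳ-≤ y P≤2[N+g]) ⟩
    y * (2 * (suc M + g)) * g           ≡⟨ regroup y g (suc M) ⟩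
    2 * (y * g) * (suc M + g)           ≤⟨ *-monoˡ-≤ (suc M + g) yg≤ ⟩
    (C + 2 * suc M * g) * (suc M + g)   ≤⟨ product-bound (suc M) 1≤g 2g≤C ⟩
    suc (suc M) * K * g                 ∎)
    where
    regroup : ∀ y g N → y * (2 * (N + g)) * g ≡ 2 * (y * g) * (N + g)
    regroup = solve-∀
    P≤2[N+g] : suc M + H + g ≤ 2 * (suc M + g)
    P≤2[N+g] = begin
      suc M + H + g                 ≡⟨ shuffle ⟩
      H + (suc M + g)               ≤⟨ +-monoˡ-≤ (suc M + g) H≤N+g ⟩
      suc M + g + (suc M + g)       ≡⟨ cong (suc M + g +_) (sym (+-identityʳ (suc M + g))) ⟩
      2 * (suc M + g)               ∎

excess-constant : ∀ M → M * (3 * M + 5) + 2 * suc M ≡ (2 + M) * (3 * (2 + M) ∸ 5)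
excess-constant M = begin
  M * (3 * M + 5) + 2 * suc M             ≡⟨ factor M ⟩
  (2 + M) * suc (3 * M)                   ≡⟨ cong ((2 + M) *_) (sym (m+n∸m≡n 5 (suc (3 * M)))) ⟩
  (2 + M) * (5 + suc (3 * M) ∸ 5)         ≡⟨ cong (λ k → (2 + M) * (k ∸ 5)) (sym (triple M)) ⟩
  (2 + M) * (3 * (2 + M) ∸ 5)             ∎
  where
  open ≡-Reasoning
  factor : ∀ M → M * (3 * M + 5) + 2 * suc M ≡ (2 + M) * suc (3 * M)
  factor = solve-∀
  triple : ∀ M → 3 * (2 + M) ≡ 5 + suc (3 * M)
  triple = solve-∀

snoc-bounds : ∀ a (h : Vec ℕ (2 + a)) y → (∀ i → suc (lookup h i) ≤ y) →
  σ 2 (map suc h ∷ʳ y) ≡ σ (3 + a) (map suc h ∷ʳ y) →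
  2 * y ≤ (3 + a) * (3 * (3 + a) ∸ 5) × σ (3 + a) (map suc h ∷ʳ y) ≤ (3 + a) * (3 + a) * (3 * (3 + a) ∸ 5)
snoc-bounds a h y h<y σ₂≡σₙ
  with excess-factor y (σ-positive h 2 (s≤s (s≤s z≤n)))
         (trans (sym (σ₂-∷ʳ-map-suc h y)) (trans σ₂≡σₙ (σ-top-∷ʳ (map suc h) y)))
... | g , 1≤g , P≡ , T≡ =
  let 2y≤K , yP≤nK = excess-bounds (suc a) {y = y} 1≤g P≡ σ₂-identity
                       (σ-top-map-suc-≥ h) (σ-top-map-suc-dichotomy h) N+H≤Ny
  in subst (2 * y ≤_) (excess-constant (suc a)) 2y≤K , (begin
    σ (3 + a) (map suc h ∷ʳ y)              ≡⟨ σ-top-∷ʳ (map suc h) y ⟩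
    y * σ (2 + a) (map suc h)               ≤⟨ yP≤nK ⟩
    (3 + a) * (suc a * (3 * suc a + 5) + 2 * (2 + a)) ≡⟨ cong ((3 + a) *_) (excess-constant (suc a)) ⟩
    (3 + a) * ((3 + a) * (3 * (3 + a) ∸ 5)) ≡⟨ sym (*-assoc (3 + a) (3 + a) (3 * (3 + a) ∸ 5)) ⟩
    (3 + a) * (3 + a) * (3 * (3 + a) ∸ 5)   ∎)
  where
  open ≤-Reasoning
  σ₂-identity : 2 * (y * g) + 2 * σ 1 h + (2 + a) ≡ (2 + a) * (2 + a) + 2 * (2 + a) * σ 1 h + 2 * σ 2 h
  σ₂-identity = subst (λ T → 2 * T + 2 * σ 1 h + (2 + a) ≡ (2 + a) * (2 + a) + 2 * (2 + a) * σ 1 h + 2 * σ 2 h) T≡ (σ₂-map-suc h)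
  N+H≤Ny : 2 + a + σ 1 h ≤ (2 + a) * y
  N+H≤Ny = subst (_≤ (2 + a) * y) (σ₁-map-suc h)
    (σ₁≤N*y (map suc h) y (λ i → subst (_≤ y) (sym (lookup-map i suc h)) (h<y i)))

lookup-∷ʳ-inject₁ : ∀ {ℓ} {A : Set ℓ} {N} (w : Vec A N) y i → lookup (w ∷ʳ y) (inject₁ i) ≡ lookup w i
lookup-∷ʳ-inject₁ (b ∷ w) y Fin.zero    = refl
lookup-∷ʳ-inject₁ (b ∷ w) y (Fin.suc i) = lookup-∷ʳ-inject₁ w y i

lookup-∷ʳ-fromℕ : ∀ {ℓ} {A : Set ℓ} {N} (w : Vec A N) y → lookup (w ∷ʳ y) (fromℕ N) ≡ y
lookup-∷ʳ-fromℕ []      y = refl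
lookup-∷ʳ-fromℕ (b ∷ w) y = lookup-∷ʳ-fromℕ w y

positive⇒map-suc : ∀ {N} (w : Vec ℕ N) → (∀ i → 1 ≤ lookup w i) → ∃[ h ] w ≡ map suc h
positive⇒map-suc []          _ = [] , refl
positive⇒map-suc (zero  ∷ w) w≥1 with w≥1 Fin.zero
... | ()
positive⇒map-suc (suc b ∷ w) w≥1 with positive⇒map-suc w (w≥1 ∘ Fin.suc)
... | h , refl = b ∷ h , refl

theorem2p7 : (n : ℕ) → 3 ≤ n → (x : Vec ℕ n)
    → (∀ (i : Fin n) → 1 ≤ lookup x i)
    → (∀ (i j : Fin n) → i Data.Fin.≤ j → lookup x i ≤ lookup x j)
    → (m : ℕ) → m ≡ σ 2 x → m ≡ σ n x
    → (m ≤ n * n * (3 * n ∸ 5))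
      × (∀ (k : ℕ) (eq : n ≡ suc k) → 2 * lookup x (cast (sym eq) (fromℕ k)) ≤ n * (3 * n ∸ 5))
theorem2p7 1 (s≤s ())
theorem2p7 2 (s≤s (s≤s ()))
theorem2p7 (suc (suc (suc a))) _ x x≥1 x-sorted m m≡σ₂ m≡σₙ with initLast x
... | u , y , refl with positive⇒map-suc u (λ i → subst (1 ≤_) (lookup-∷ʳ-inject₁ u y i) (x≥1 (inject₁ i)))
... | h , refl = subst (_≤ _) (sym m≡σₙ) (proj₂ bounds) , last-bound
  where
  h<y : ∀ i → suc (lookup h i) ≤ y
  h<y i = subst₂ _≤_ (trans (lookup-∷ʳ-inject₁ (map suc h) y i) (lookup-map i suc h)) (lookup-∷ʳ-fromℕ (map suc h) y)
    (x-sorted (inject₁ i) (fromℕ (2 + a)) (≤fromℕ (inject₁ i)))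
  bounds : 2 * y ≤ (3 + a) * (3 * (3 + a) ∸ 5) × σ (3 + a) (map suc h ∷ʳ y) ≤ (3 + a) * (3 + a) * (3 * (3 + a) ∸ 5)
  bounds = snoc-bounds a h y h<y (trans (sym m≡σ₂) m≡σₙ)
  last-bound : ∀ k (eq : 3 + a ≡ suc k) → 2 * lookup (map suc h ∷ʳ y) (cast (sym eq) (fromℕ k)) ≤ (3 + a) * (3 * (3 + a) ∸ 5)
  last-bound k refl rewrite cast-is-id refl (fromℕ k) | lookup-∷ʳ-fromℕ (map suc h) y = proj₁ bounds
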